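{- Let $p$ be an odd prime, $n\geq 1$, and $a_1,a_2,\ldots,a_{n+1}\in\mathbb{F}_p$ with $a_{n+1}\neq 0$. Consider the permutation polynomial \[\widetilde{\mathcal{P}}_{2n}(x)=(\cdots(((\cdots((x+a_1)^{p-2}+a_2)^{p-2}+\cdots+a_n)^{p-2}+a_{n+1})^{p-2}-a_{n})^{p-2}-\cdots-a_2)^{p-2}-a_1\in\mathbb{F}_p[x].\] Then for every $k\geq 1$, the $k$th iterate (the $k$-fold composition of $\widetilde{\mathcal{P}}_{2n}$ with itself, reduced modulo $x^p-x$) is \[\widetilde{\mathcal{P}}_{2n}^{(k)}(x)=(\cdots(((\cdots((x+a_1)^{p-2}+a_2)^{p-2}+\cdots+a_n)^{p-2}+ka_{n+1})^{p-2}-a_{n})^{p-2}-\cdots-a_2)^{p-2}-a_1,\] i.e. the same expression with $a_{n+1}$ replaced by $ka_{n+1}$; these iterates are the elements of the Sylow $p$-subgroup (of the group of permutation polynomials over $\mathbb{F}_p$) generated by $\widetilde{\mathcal{P}}_{2n}(x)$.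
   Context: Permutation polynomials over $\mathbb{F}_p$ form a group under composition and reduction modulo $x^p-x$, isomorphic to the symmetric group $S_p$. The polynomial $\widetilde{\mathcal{P}}_{2n}(x)$ above induces a permutation of $\mathbb{F}_p$ with a single cycle of length $p$ (full cycle). -}

module Defs where

open import Data.Nat using (ℕ; zero; suc; _+_; _*_; _∸_; _^_; NonZero)
open import Data.Nat.DivMod using (_%_)

-- Arithmetic of F_p on representatives 0 ≤ y < p (results reduced mod p).
module Fp (p : ℕ) .{{_ : NonZero p}} where

  add : ℕ → ℕ → ℕ
  add y b = (y + b) % p

  -- y - b in F_p  (for b < p)
  sub : ℕ → ℕ → ℕ
  sub y b = (y + (p ∸ b)) % p

  pw : ℕ → ℕ
  pw y = (y ^ (p ∸ 2)) % p

  scale : ℕ → ℕ → ℕ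
  scale k b = (k * b) % p

  -- Coefficients are given as a : ℕ → ℕ; only a 1, …, a (n+1) matter.
  -- up j x = ((…((x + a₁)^(p-2) + a₂)^(p-2) + …) + a_j)^(p-2)
  up : (ℕ → ℕ) → ℕ → ℕ → ℕ
  up a zero    x = x
  up a (suc j) x = pw (add (up a j x) (a (suc j)))

  -- dn a j y applies y ↦ (y - a_i)^(p-2) successively for i = j+1, j, …, 2
  dn : (ℕ → ℕ) → ℕ → ℕ → ℕ
  dn a zero    y = y
  dn a (suc j) y = dn a j (pw (sub y (a (suc (suc j)))))

  -- P̃_{2n} with the middle constant a_{n+1} replaced by c:
  -- (…((…((x+a₁)^(p-2)+a₂)^(p-2)+…+a_n)^(p-2)+c)^(p-2)-a_n)^(p-2)-…-a₂)^(p-2)-a₁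
  Ptilde : ℕ → (ℕ → ℕ) → ℕ → ℕ → ℕ
  Ptilde n a c x = sub (dn a (n ∸ 1) (pw (add (up a n x) c))) (a 1)

iter : {A : Set} → (A → A) → ℕ → A → A
iter f zero    x = x
iter f (suc k) x = f (iter f k x)

-- P̃ with middle constant c is ψ ∘ (_+ c) ∘ φ, where φ = up a n applies the first n steps
-- y ↦ (y + aᵢ)^(p-2) and ψ = up⁻¹ a (n - 1) undoes them. Since (p-2)² ≡ 1 mod p-1, Fermat's
-- little theorem makes y ↦ y^(p-2) an involution of F_p, so φ ∘ ψ = id and the k-fold composite
-- telescopes to ψ ∘ (_+ k c) ∘ φ. Fermat itself follows from (x + y)^p ≡ x^p + y^p mod p, the
-- inner binomial coefficients of p being divisible by p.
module Submission where

open import Defs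
open import Data.Nat
open import Data.Nat.Properties
open import Data.Nat.DivMod
open import Data.Nat.Divisibility
open import Data.Nat.Combinatorics
open import Data.Nat.Primality using (Prime; euclidsLemma; ¬prime[1])
open import Data.Fin as Fin using (Fin; toℕ; fromℕ; inject₁)
open import Data.Fin.Properties using (toℕ-fromℕ; inject₁ℕ<)
open import Data.Vec.Functional using (Vector; init; tail)
open import Data.Sum using (inj₁; inj₂)
open import Function using (_∘_)
open import Relation.Nullary using (¬_; contradiction)
open import Relation.Binary.PropositionalEquality
open import Data.Nat.Tactic.RingSolver using (solve-∀)
import Algebra.Properties.CommutativeSemiring.Binomial +-*-commutativeSemiring as Binomial
open import Algebra.Definitions.RawSemiring +-*-rawSemiring using (_×_) renaming (_^_ to _^ˢ_)
open import Algebra.Properties.Monoid.Sum +-0-monoid using (sum; sum-init-last)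
open ≡-Reasoning

[m%d+n]%d≡[m+n]%d : ∀ m n d .{{_ : NonZero d}} → (m % d + n) % d ≡ (m + n) % d
[m%d+n]%d≡[m+n]%d m n d = begin
  (m % d + n) % d           ≡⟨ %-distribˡ-+ (m % d) n d ⟩
  (m % d % d + n % d) % d   ≡⟨ cong (λ r → (r + n % d) % d) (m%n%n≡m%n m d) ⟩
  (m % d + n % d) % d       ≡⟨ %-distribˡ-+ m n d ⟨
  (m + n) % d               ∎

[m+n%d]%d≡[m+n]%d : ∀ m n d .{{_ : NonZero d}} → (m + n % d) % d ≡ (m + n) % d
[m+n%d]%d≡[m+n]%d m n d = begin
  (m + n % d) % d  ≡⟨ cong (_% d) (+-comm m (n % d)) ⟩
  (n % d + m) % d  ≡⟨ [m%d+n]%d≡[m+n]%d n m d ⟩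
  (n + m) % d      ≡⟨ cong (_% d) (+-comm n m) ⟩
  (m + n) % d      ∎

[m%d*n]%d≡[m*n]%d : ∀ m n d .{{_ : NonZero d}} → (m % d * n) % d ≡ (m * n) % d
[m%d*n]%d≡[m*n]%d m n d = begin
  (m % d * n) % d           ≡⟨ %-distribˡ-* (m % d) n d ⟩
  (m % d % d * (n % d)) % d ≡⟨ cong (λ r → (r * (n % d)) % d) (m%n%n≡m%n m d) ⟩
  (m % d * (n % d)) % d     ≡⟨ %-distribˡ-* m n d ⟨
  (m * n) % d               ∎

[m*n%d]%d≡[m*n]%d : ∀ m n d .{{_ : NonZero d}} → (m * (n % d)) % d ≡ (m * n) % d
[m*n%d]%d≡[m*n]%d m n d = begin
  (m * (n % d)) % d  ≡⟨ cong (_% d) (*-comm m (n % d)) ⟩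
  (n % d * m) % d    ≡⟨ [m%d*n]%d≡[m*n]%d n m d ⟩
  (n * m) % d        ≡⟨ cong (_% d) (*-comm n m) ⟩
  (m * n) % d        ∎

[m%d]^e%d≡m^e%d : ∀ m e d .{{_ : NonZero d}} → (m % d) ^ e % d ≡ m ^ e % d
[m%d]^e%d≡m^e%d m zero    d = refl
[m%d]^e%d≡m^e%d m (suc e) d = begin
  (m % d * (m % d) ^ e) % d        ≡⟨ [m%d*n]%d≡[m*n]%d m _ d ⟩
  (m * (m % d) ^ e) % d            ≡⟨ [m*n%d]%d≡[m*n]%d m _ d ⟨
  (m * ((m % d) ^ e % d)) % d      ≡⟨ cong (λ r → (m * r) % d) ([m%d]^e%d≡m^e%d m e d) ⟩
  (m * (m ^ e % d)) % d            ≡⟨ [m*n%d]%d≡[m*n]%d m _ d ⟩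
  (m * m ^ e) % d                  ∎

C*k!*[n∸k]!≡n! : ∀ {n k} → k ≤ n → (n C k) * (k ! * (n ∸ k) !) ≡ n !
C*k!*[n∸k]!≡n! {n} {k} k≤n = begin
  (n C k) * (k ! * (n ∸ k) !)                    ≡⟨ cong (_* (k ! * (n ∸ k) !)) (nCk≡n!/k![n-k]! k≤n) ⟩
  (n ! / (k ! * (n ∸ k) !)) * (k ! * (n ∸ k) !)  ≡⟨ m/n*n≡m (k![n∸k]!∣n! k≤n) ⟩
  n !                                            ∎
  where
  instance
    k!*[n∸k]!≢0 : NonZero (k ! * (n ∸ k) !)
    k!*[n∸k]!≢0 = k !* (n ∸ k) !≢0

prime∤! : ∀ {p m} → Prime p → m < p → ¬ p ∣ m !
prime∤! {m = zero}  pr _   p∣1 = ¬prime[1] (subst Prime (∣1⇒≡1 p∣1) pr)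
prime∤! {m = suc m} pr m<p p∣m! with euclidsLemma (suc m) (m !) pr p∣m!
... | inj₁ p∣1+m = >⇒∤ m<p p∣1+m
... | inj₂ p∣m!  = prime∤! pr (<-trans (n<1+n m) m<p) p∣m!

prime∣C : ∀ {p k} → Prime p → 0 < k → k < p → p ∣ p C k
prime∣C {zero} _ _ ()
prime∣C {p@(suc q)} {k} pr 0<k k<p with euclidsLemma (p C k) (k ! * (p ∸ k) !) pr p∣C*k!*[p∸k]!
  where
  p∣C*k!*[p∸k]! : p ∣ (p C k) * (k ! * (p ∸ k) !)
  p∣C*k!*[p∸k]! = subst (p ∣_) (sym (C*k!*[n∸k]!≡n! (<⇒≤ k<p))) (m∣m*n (q !))
... | inj₁ p∣C = p∣C
... | inj₂ p∣k!*[p∸k]! with euclidsLemma (k !) ((p ∸ k) !) pr p∣k!*[p∸k]!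
...   | inj₁ p∣k!     = contradiction p∣k! (prime∤! pr k<p)
...   | inj₂ p∣[p∸k]! = contradiction p∣[p∸k]! (prime∤! pr (∸-monoʳ-< 0<k (<⇒≤ k<p)))

×≡* : ∀ m n → m × n ≡ m * n
×≡* zero    n = refl
×≡* (suc m) n = cong (n +_) (×≡* m n)

^ˢ≡^ : ∀ x n → x ^ˢ n ≡ x ^ n
^ˢ≡^ x zero    = refl
^ˢ≡^ x (suc n) = cong (x *_) (^ˢ≡^ x n)

∣-sum : ∀ {d n} (f : Vector ℕ n) → (∀ i → d ∣ f i) → d ∣ sum f
∣-sum {d} {zero}  f _   = d ∣0
∣-sum {n = suc n} f d∣f = ∣m∣n⇒∣m+n (d∣f Fin.zero) (∣-sum (tail f) (d∣f ∘ Fin.suc))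

binomialTerm≡ : ∀ x y n (i : Fin (suc n)) →
  Binomial.binomialTerm x y n i ≡ (n C toℕ i) * (x ^ toℕ i * y ^ (n ∸ toℕ i))
binomialTerm≡ x y n i = begin
  (n C k) × (x ^ˢ k * y ^ˢ (n ∸ k)) ≡⟨ ×≡* (n C k) _ ⟩
  (n C k) * (x ^ˢ k * y ^ˢ (n ∸ k)) ≡⟨ cong₂ (λ u v → (n C k) * (u * v)) (^ˢ≡^ x k) (^ˢ≡^ y (n ∸ k)) ⟩
  (n C k) * (x ^ k * y ^ (n ∸ k)) ∎
  where k = toℕ i

freshman's-dream : ∀ {p} .{{_ : NonZero p}} → Prime p → ∀ x y → (x + y) ^ p % p ≡ (x ^ p + y ^ p) % p
freshman's-dream {p@(suc q)} pr x y = begin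
  (x + y) ^ p % p
    ≡⟨ cong (_% p) (trans (sym (^ˢ≡^ (x + y) p)) (Binomial.theorem p x y)) ⟩
  sum t % p
    ≡⟨ cong (λ s → (t Fin.zero + s) % p) (sum-init-last (tail t)) ⟩
  (t Fin.zero + (sum middle + t (fromℕ p))) % p
    ≡⟨ cong (_% p) (trans (+-comm (t Fin.zero) _) (+-assoc (sum middle) _ _)) ⟩
  (sum middle + (t (fromℕ p) + t Fin.zero)) % p
    ≡⟨ %-remove-+ˡ _ (∣-sum middle p∣middle) ⟩
  (t (fromℕ p) + t Fin.zero) % p
    ≡⟨ cong₂ (λ u v → (u + v) % p) last-term first-term ⟩
  (x ^ p + y ^ p) % p
    ∎
  where
  t : Vector ℕ (suc p)
  t = Binomial.binomialTerm x y p
  middle : Vector ℕ q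
  middle = init (tail t)
  p∣middle : ∀ i → p ∣ middle i
  p∣middle i = subst (p ∣_) (sym (binomialTerm≡ x y p (Fin.suc (inject₁ i))))
                 (∣m⇒∣m*n _ (prime∣C pr z<s (s<s (inject₁ℕ< i))))
  first-term : t Fin.zero ≡ y ^ p
  first-term = trans (binomialTerm≡ x y p Fin.zero) (trans (+-identityʳ _) (*-identityˡ _))
  last-term : t (fromℕ p) ≡ x ^ p
  last-term = begin
    t (fromℕ p)                            ≡⟨ binomialTerm≡ x y p (fromℕ p) ⟩
    _                                      ≡⟨ cong (λ k → (p C k) * (x ^ k * y ^ (p ∸ k))) (toℕ-fromℕ p) ⟩
    (p C p) * (x ^ p * y ^ (p ∸ p))        ≡⟨ cong₂ (λ c e → c * (x ^ p * y ^ e)) (nCn≡1 p) (n∸n≡0 p) ⟩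
    1 * (x ^ p * 1)                        ≡⟨ trans (*-identityˡ _) (*-identityʳ _) ⟩
    x ^ p                                  ∎

fermat : ∀ {p} .{{_ : NonZero p}} → Prime p → ∀ x → x ^ p % p ≡ x % p
fermat {suc q} pr zero    = refl
fermat {p}     pr (suc x) = begin
  (1 + x) ^ p % p        ≡⟨ freshman's-dream pr 1 x ⟩
  (1 ^ p + x ^ p) % p    ≡⟨ cong (λ r → (r + x ^ p) % p) (^-zeroˡ p) ⟩
  (1 + x ^ p) % p        ≡⟨ [m+n%d]%d≡[m+n]%d 1 (x ^ p) p ⟨
  (1 + x ^ p % p) % p    ≡⟨ cong (λ r → (1 + r) % p) (fermat pr x) ⟩
  (1 + x % p) % p        ≡⟨ [m+n%d]%d≡[m+n]%d 1 x p ⟩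
  (1 + x) % p            ∎

fermat-^[1+[p∸1]*t] : ∀ {p} .{{_ : NonZero p}} → Prime p → ∀ x t → x ^ (1 + (p ∸ 1) * t) % p ≡ x % p
fermat-^[1+[p∸1]*t] {p@(suc m)} pr x zero =
  trans (cong (λ e → x ^ (1 + e) % p) (*-zeroʳ m)) (cong (_% p) (*-identityʳ x))
fermat-^[1+[p∸1]*t] {p@(suc m)} pr x (suc t) = begin
  x ^ (1 + m * suc t) % p           ≡⟨ cong (λ e → x ^ e % p) (exponent m t) ⟩
  x ^ (m + (1 + m * t)) % p         ≡⟨ cong (_% p) (^-distribˡ-+-* x m (1 + m * t)) ⟩
  (x ^ m * x ^ (1 + m * t)) % p     ≡⟨ [m*n%d]%d≡[m*n]%d (x ^ m) _ p ⟨
  (x ^ m * (x ^ (1 + m * t) % p)) % p ≡⟨ cong (λ r → (x ^ m * r) % p) (fermat-^[1+[p∸1]*t] pr x t) ⟩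
  (x ^ m * (x % p)) % p             ≡⟨ [m*n%d]%d≡[m*n]%d (x ^ m) x p ⟩
  (x ^ m * x) % p                   ≡⟨ cong (_% p) (*-comm (x ^ m) x) ⟩
  x ^ p % p                         ≡⟨ fermat pr x ⟩
  x % p                             ∎
  where
  exponent : ∀ m t → 1 + m * suc t ≡ m + (1 + m * t)
  exponent = solve-∀

pw-involutive : ∀ {p} .{{_ : NonZero p}} → Prime p → 2 < p → ∀ {y} → y < p → Fp.pw p (Fp.pw p y) ≡ y
pw-involutive {p@(suc (suc (suc r)))} pr (s≤s (s≤s (s≤s z≤n))) {y} y<p = begin
  (y ^ suc r % p) ^ suc r % p   ≡⟨ [m%d]^e%d≡m^e%d (y ^ suc r) (suc r) p ⟩
  (y ^ suc r) ^ suc r % p       ≡⟨ cong (_% p) (^-*-assoc y (suc r) (suc r)) ⟩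
  y ^ (suc r * suc r) % p       ≡⟨ cong (λ e → y ^ e % p) (exponent r) ⟩
  y ^ (1 + (2 + r) * r) % p     ≡⟨ fermat-^[1+[p∸1]*t] pr y r ⟩
  y % p                         ≡⟨ m<n⇒m%n≡m y<p ⟩
  y                             ∎
  where
  exponent : ∀ r → suc r * suc r ≡ 1 + (2 + r) * r
  exponent = solve-∀

iter-conjugate : ∀ {A B : Set} (φ : A → B) (ψ : B → A) (t : B → B) →
  (∀ z → φ (ψ (t z)) ≡ t z) → ∀ k x → iter (ψ ∘ t ∘ φ) (suc k) x ≡ ψ (iter t (suc k) (φ x))
iter-conjugate φ ψ t φψt≡t zero    x = refl
iter-conjugate φ ψ t φψt≡t (suc k) x =
  cong (ψ ∘ t) (trans (cong φ (iter-conjugate φ ψ t φψt≡t k x)) (φψt≡t (iter t k (φ x))))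

module _ {p : ℕ} .{{_ : NonZero p}} where
  open Fp p

  add-sub : ∀ {y b} → y < p → b ≤ p → add (sub y b) b ≡ y
  add-sub {y} {b} y<p b≤p = begin
    ((y + (p ∸ b)) % p + b) % p  ≡⟨ [m%d+n]%d≡[m+n]%d (y + (p ∸ b)) b p ⟩
    (y + (p ∸ b) + b) % p        ≡⟨ cong (_% p) (+-assoc y (p ∸ b) b) ⟩
    (y + (p ∸ b + b)) % p        ≡⟨ cong (λ r → (y + r) % p) (m∸n+n≡m b≤p) ⟩
    (y + p) % p                  ≡⟨ [m+n]%n≡m%n y p ⟩
    y % p                        ≡⟨ m<n⇒m%n≡m y<p ⟩
    y                            ∎

  iter-add : ∀ c k {u} → u < p → iter (λ z → add z c) k u ≡ add u (scale k c)
  iter-add c zero {u} u<p = begin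
    u              ≡⟨ m<n⇒m%n≡m u<p ⟨
    u % p           ≡⟨ cong (_% p) (+-identityʳ u) ⟨
    (u + 0) % p     ≡⟨ cong (λ r → (u + r) % p) (m*n%n≡0 0 p) ⟨
    (u + 0 % p) % p ∎
  iter-add c (suc k) {u} u<p = begin
    add (iter (λ z → add z c) k u) c     ≡⟨ cong (λ r → add r c) (iter-add c k u<p) ⟩
    ((u + kc % p) % p + c) % p           ≡⟨ [m%d+n]%d≡[m+n]%d (u + kc % p) c p ⟩
    (u + kc % p + c) % p                 ≡⟨ cong (_% p) (x+y+z≡x+z+y u (kc % p) c) ⟩
    (u + c + kc % p) % p                 ≡⟨ [m+n%d]%d≡[m+n]%d (u + c) kc p ⟩
    (u + c + kc) % p                     ≡⟨ cong (_% p) (+-assoc u c kc) ⟩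
    (u + (c + kc)) % p                   ≡⟨ [m+n%d]%d≡[m+n]%d u (c + kc) p ⟨
    (u + (c + kc) % p) % p               ∎
    where
    kc : ℕ
    kc = k * c
    x+y+z≡x+z+y : ∀ x y z → x + y + z ≡ x + z + y
    x+y+z≡x+z+y = solve-∀

  up⁻¹ : (ℕ → ℕ) → ℕ → ℕ → ℕ
  up⁻¹ a j z = sub (dn a j (pw z)) (a 1)

ReducedUpTo : ℕ → (ℕ → ℕ) → ℕ → Set
ReducedUpTo p a j = ∀ i → 1 ≤ i → i ≤ j → a i < p

reducedUpTo-pred : ∀ {p a j} → ReducedUpTo p a (suc j) → ReducedUpTo p a j
reducedUpTo-pred a<p i 1≤i i≤j = a<p i 1≤i (m≤n⇒m≤1+n i≤j)

module _ {p : ℕ} .{{_ : NonZero p}} (p-prime : Prime p) (2<p : 2 < p) (a : ℕ → ℕ) where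
  open Fp p

  add-up-dn : ∀ j → ReducedUpTo p a (suc j) → ∀ {y} → y < p →
    add (up a j (sub (dn a j y) (a 1))) (a (suc j)) ≡ y
  add-up-dn zero    a<p y<p = add-sub y<p (<⇒≤ (a<p 1 ≤-refl ≤-refl))
  add-up-dn (suc j) a<p {y} y<p = begin
    add (pw (add (up a j w) (a (suc j)))) b
      ≡⟨ cong (λ r → add (pw r) b) (add-up-dn j (reducedUpTo-pred a<p) (m%n<n _ p)) ⟩
    add (pw (pw (sub y b))) b
      ≡⟨ cong (λ r → add r b) (pw-involutive p-prime 2<p (m%n<n _ p)) ⟩
    add (sub y b) b
      ≡⟨ add-sub y<p (<⇒≤ (a<p (2 + j) (s≤s z≤n) ≤-refl)) ⟩
    y ∎
    where
    b w : ℕ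
    b = a (2 + j)
    w = sub (dn a j (pw (sub y b))) (a 1)

  up∘up⁻¹ : ∀ j → ReducedUpTo p a (suc j) → ∀ {z} → z < p → up a (suc j) (up⁻¹ a j z) ≡ z
  up∘up⁻¹ j a<p z<p = trans (cong pw (add-up-dn j a<p (m%n<n _ p))) (pw-involutive p-prime 2<p z<p)

mainTheorem2 : (p : ℕ) .{{_ : NonZero p}} → Prime p → 2 < p →
    (n : ℕ) → 1 ≤ n →
    (a : ℕ → ℕ) → (∀ i → 1 ≤ i → i ≤ suc n → a i < p) → a (suc n) ≢ 0 →
    (k : ℕ) → 1 ≤ k → (x : ℕ) → x < p →
    iter (Fp.Ptilde p n a (a (suc n))) k x ≡ Fp.Ptilde p n a (Fp.scale p k (a (suc n))) x
mainTheorem2 p pr 2<p (suc m) _ a a<p _ (suc k) _ x _ = begin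
  iter (Ptilde (suc m) a c) (suc k) x
    ≡⟨ iter-conjugate (up a (suc m)) (up⁻¹ a m) (λ z → add z c) up∘up⁻¹∘+c k x ⟩
  up⁻¹ a m (iter (λ z → add z c) (suc k) (up a (suc m) x))
    ≡⟨ cong (up⁻¹ a m) (iter-add c (suc k) (m%n<n _ p)) ⟩
  Ptilde (suc m) a (scale (suc k) c) x
    ∎
  where
  open Fp p
  c : ℕ
  c = a (2 + m)
  up∘up⁻¹∘+c : ∀ z → up a (suc m) (up⁻¹ a m (add z c)) ≡ add z c
  up∘up⁻¹∘+c z = up∘up⁻¹ pr 2<p a m (reducedUpTo-pred a<p) (m%n<n _ p)
mainTheorem2 _ _ _ zero () _ _ _ _ _ _ _
mainTheorem2 _ _ _ (suc _) _ _ _ _ zero () _ _
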